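{- Let $q$ be a prime power and $1\le t\le k\le n$ integers, and let $\mathbb{S}$ be a $q$-Steiner system $S_q(t,k,n)$. Let $\mathbb{S}'$ be the multiset $\{B' : B\in\mathbb{S}\}$, where $B'\subseteq\mathbb{F}_q^{n-1}$ is obtained from $B$ by deleting the last coordinate of every vector. Then: (i) the members of $\mathbb{S}'$ of dimension $k-1$ are exactly $\frac{\binom{n-1}{t-1}_q}{\binom{k-1}{t-1}_q}$ pairwise distinct $(k-1)$-subspaces of $\mathbb{F}_q^{n-1}$, and the set $\tilde{\mathbb{S}}$ of these subspaces is a $q$-Steiner system $S_q(t-1,k-1,n-1)$; (ii) every $t$-dimensional subspace of $\mathbb{F}_q^{n-1}$ which is contained in some member of $\tilde{\mathbb{S}}$ is contained in none of the $k$-dimensional members of $\mathbb{S}'$; (iii) every $t$-dimensional subspace of $\mathbb{F}_q^{n-1}$ which is contained in no member of $\tilde{\mathbb{S}}$ is contained in exactly $q^t$ of the $k$-dimensional members of $\mathbb{S}'$, counted with multiplicity.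
   Context: $\mathbb{F}_q$ is the finite field with $q$ elements. A $q$-Steiner system $S_q(t,k,n)$ is a collection $\mathbb{S}$ of $k$-dimensional subspaces of $\mathbb{F}_q^n$ (blocks) such that every $t$-dimensional subspace of $\mathbb{F}_q^n$ is contained in exactly one block. The Gaussian coefficient is $\binom{n}{k}_q=\frac{(q^n-1)(q^{n-1}-1)\cdots(q^{n-k+1}-1)}{(q^k-1)(q^{k-1}-1)\cdots(q-1)}$, with $\binom{n}{0}_q=1$. -}

module Defs where

open import Level using (0ℓ)
open import Data.Nat using (ℕ; zero; suc)
import Data.Nat as N
open import Data.Fin using (Fin; inject₁)
open import Data.Product using (Σ; ∃; _×_; _,_)
open import Data.Vec.Functional using (Vector; foldr)
open import Relation.Nullary using (¬_)
open import Relation.Binary.PropositionalEquality as ≡ using (_≡_)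
open import Algebra.Bundles using (CommutativeRing)
open import Function.Bundles using (Inverse)
open import Function.Definitions using (Injective)

record FiniteField (q : ℕ) : Set₁ where
  field
    commRing : CommutativeRing 0ℓ 0ℓ
  open CommutativeRing commRing public
  field
    0≉1     : ¬ (0# ≈ 1#)
    inverse : ∀ x → ¬ (x ≈ 0#) → ∃ λ y → x * y ≈ 1#
    card    : Inverse setoid (≡.setoid (Fin q))

-- Gaussian coefficient [n choose k]_q, via the q-Pascal recursion
--   [n+1, k+1]_q = [n, k]_q + q^(k+1) [n, k+1]_q ,  [n,0]_q = 1, [0,k+1]_q = 0

gauss : ℕ → ℕ → ℕ → ℕ
gauss q n       zero    = 1
gauss q zero    (suc k) = 0
gauss q (suc n) (suc k) = gauss q n k N.+ q N.^ suc k N.* gauss q n (suc k)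

-- Counting indices (with multiplicity): exactly c indices i : Fin b
-- satisfy P, witnessed by an injective enumeration of them.

HasCount : (b : ℕ) → (Fin b → Set) → ℕ → Set
HasCount b P c =
  Σ (Fin c → Fin b) λ e →
    Injective _≡_ _≡_ e × (∀ j → P (e j)) × (∀ i → P i → ∃ λ j → e j ≡ i)

module Lin {q : ℕ} (F : FiniteField q) where
  open FiniteField F

  Vec : ℕ → Set
  Vec n = Vector Carrier n

  _≈ᵛ_ : ∀ {n} → Vec n → Vec n → Set
  u ≈ᵛ v = ∀ i → u i ≈ v i

  lincomb : ∀ {m n} → (Fin m → Carrier) → (Fin m → Vec n) → Vec n
  lincomb {m} c g i = foldr _+_ 0# {m} (λ j → c j * g j i)

  -- a subspace of F_q^n, given as the span of a finite family of vectors
  record Subspace (n : ℕ) : Set where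
    constructor span
    field
      {gens} : ℕ
      gen    : Fin gens → Vec n

  _∈_ : ∀ {n} → Vec n → Subspace n → Set
  v ∈ span g = ∃ λ c → v ≈ᵛ lincomb c g

  _⊆_ : ∀ {n} → Subspace n → Subspace n → Set
  U ⊆ W = ∀ v → v ∈ U → v ∈ W

  _≐_ : ∀ {n} → Subspace n → Subspace n → Set
  U ≐ W = U ⊆ W × W ⊆ U

  LinIndep : ∀ {m n} → (Fin m → Vec n) → Set
  LinIndep {m} g = ∀ c → lincomb c g ≈ᵛ (λ _ → 0#) → ∀ j → c j ≈ 0#

  HasDim : ∀ {n} → Subspace n → ℕ → Set
  HasDim {n} U d =
    Σ (Fin d → Vec n) λ b → LinIndep b × (span b ≐ U)

  IsSteiner : (t k n b : ℕ) → (Fin b → Subspace n) → Set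
  IsSteiner t k n b B =
    (∀ i → HasDim (B i) k) ×
    (∀ T → HasDim T t →
       ∃ λ i → (T ⊆ B i) × (∀ j → T ⊆ B j → j ≡ i))

  puncture : ∀ {n} → Subspace (suc n) → Subspace n
  puncture (span g) = span (λ j i → g j (inject₁ i))

module Submission where

-- Let ê be the last standard basis vector of F_q^{n+1}.  Puncturing a
-- subspace U (deleting the last coordinate) keeps its dimension if ê ∉ U
-- and lowers it by one if ê ∈ U.  Subspaces containing ê are determined by
-- their puncturing: they are the cones hat T = T ⊕ ⟨ê⟩.  The subspaces
-- avoiding ê that puncture onto a t-space T = ⟨β⟩ are exactly its q^t lifts
-- ⟨β_r ∷ʳ c_r⟩, one for each c ∈ F_q^t.
--
-- Finally, for an S_q(t,k,n+1) the blocks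
-- through ê puncture to an S_q(t-1,k-1,n), since the cone over a
-- (t-1)-space lies in a unique block; a t-space T of F_q^n reaches the
-- other blocks only through its lifts, each lift lying in one block: no
-- such block if T is covered by the derived system (ii), and q^t distinct
-- blocks otherwise (iii).

open import Data.Nat as ℕ using (ℕ; zero; suc; z≤n; s≤s)
import Data.Nat.Properties as ℕₚ
open import Data.Fin using (Fin; zero; suc; inject₁; fromℕ; fromℕ<; punchIn; punchOut; combine; remQuot)
import Data.Fin.Properties as Finₚ
open import Data.Product using (∃; _×_; _,_; proj₁; proj₂)
open import Data.Sum using (_⊎_; inj₁; inj₂)
open import Data.Empty using (⊥-elim)
open import Data.Vec.Functional using (_∷_; []; head; tail; init; last; insertAt)
import Data.Vec.Functional.Properties as Vecₚ
open import Relation.Nullary using (¬_; Dec; yes; no)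
open import Relation.Nullary.Decidable using (map′; ¬?; decidable-stable)
open import Relation.Unary using (Decidable)
open import Relation.Binary.PropositionalEquality as ≡ using (_≡_; _≢_)
open import Function.Bundles using (Inverse; _↔_)
open import Function.Construct.Identity using (↔-id)
open import Function.Construct.Composition using (_↔-∘_)
open import Data.Sum.Function.Propositional using (_⊎-↔_)
open import Function.Definitions using (Injective)
open import Function.Base using (_∘_)
open import Defs
import Algebra.Properties.Semiring.Sum as SemiringSum
import Algebra.Properties.Ring as RingProperties
import Algebra.Properties.Group as GroupProperties
import Relation.Binary.Reasoning.Setoid as SetoidReasoning

decidable-count : ∀ {b} (P : Fin b → Set) → Decidable P → ∃ (HasCount b P)
decidable-count {zero} _ _ = 0 , (λ ()) , (λ { {()} }) , (λ ()) , (λ ())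
decidable-count {suc b} P P? with decidable-count (λ i → P (suc i)) (λ i → P? (suc i)) | P? zero
... | c , e , e-inj , e-sat , e-hit | yes P0 = suc c , e′ , e′-inj , e′-sat , e′-hit
  where
  e′ : Fin (suc c) → Fin (suc b)
  e′ zero    = zero
  e′ (suc j) = suc (e j)
  e′-inj : Injective _≡_ _≡_ e′
  e′-inj {zero}  {zero}  _  = ≡.refl
  e′-inj {suc x} {suc y} eq = ≡.cong suc (e-inj (Finₚ.suc-injective eq))
  e′-sat : ∀ j → P (e′ j)
  e′-sat zero    = P0
  e′-sat (suc j) = e-sat j
  e′-hit : ∀ i → P i → ∃ λ j → e′ j ≡ i
  e′-hit zero    _  = zero , ≡.refl
  e′-hit (suc i) Pi = let j , ej≡i = e-hit i Pi in suc j , ≡.cong suc ej≡i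
... | c , e , e-inj , e-sat , e-hit | no ¬P0 =
  c , (λ j → suc (e j)) , (λ eq → e-inj (Finₚ.suc-injective eq)) , e-sat , e′-hit
  where
  e′-hit : ∀ i → P i → ∃ λ j → suc (e j) ≡ i
  e′-hit zero    P0 = ⊥-elim (¬P0 P0)
  e′-hit (suc i) Pi = let j , ej≡i = e-hit i Pi in j , ≡.cong suc ej≡i

gauss-positive : ∀ q k t → t ℕ.≤ k → 1 ℕ.≤ gauss q k t
gauss-positive q k       zero    _         = s≤s z≤n
gauss-positive q (suc k) (suc t) (s≤s t≤k) = ℕₚ.≤-trans (gauss-positive q k t t≤k) (ℕₚ.m≤m+n _ _)

module Geometry {q : ℕ} (F : FiniteField q) where
  open FiniteField F hiding (zero)
  open Lin F
  open SemiringSum semiring using (sum-cong-≋; ∑-distrib-+; sum-remove; *-distribˡ-sum; sum-replicate-zero)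
  open RingProperties ring using (-1*x≈-x)
  open GroupProperties +-group using (x∙y⁻¹≈ε⇒x≈y; inverseˡ-unique)
  open SetoidReasoning setoid

  1≉0 : ¬ (1# ≈ 0#)
  1≉0 p = 0≉1 (sym p)

  -- Equality of field elements is decidable, since F is finite.
  _≟_ : (x y : Carrier) → Dec (x ≈ y)
  x ≟ y = map′ to-injective (Inverse.to-cong card) (Inverse.to card x Finₚ.≟ Inverse.to card y)
    where
    to-injective : Inverse.to card x ≡ Inverse.to card y → x ≈ y
    to-injective eq = begin
      x                                     ≈⟨ sym (Inverse.strictlyInverseʳ card x) ⟩
      Inverse.from card (Inverse.to card x) ≡⟨ ≡.cong (Inverse.from card) eq ⟩
      Inverse.from card (Inverse.to card y) ≈⟨ Inverse.strictlyInverseʳ card y ⟩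
      y                                     ∎

  0ᵛ : ∀ {n} → Vec n
  0ᵛ _ = 0#

  -- binding tighter than the relations _≈ᵛ_ and _∈_ (default fixity 20)
  infixl 30 _+ᵛ_ _-ᵛ_
  infixr 31 _•_

  _+ᵛ_ _-ᵛ_ : ∀ {n} → Vec n → Vec n → Vec n
  (u +ᵛ v) i = u i + v i
  (u -ᵛ v) i = u i - v i

  _•_ : ∀ {n} → Carrier → Vec n → Vec n
  (a • v) i = a * v i

  ≈ᵛ-sym : ∀ {n} {u v : Vec n} → u ≈ᵛ v → v ≈ᵛ u
  ≈ᵛ-sym p i = sym (p i)

  ≈ᵛ-trans : ∀ {n} {u v w : Vec n} → u ≈ᵛ v → v ≈ᵛ w → u ≈ᵛ w
  ≈ᵛ-trans p r i = trans (p i) (r i)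

  -ᵛ≈0⇒≈ : ∀ {n} {u v : Vec n} → u -ᵛ v ≈ᵛ 0ᵛ → u ≈ᵛ v
  -ᵛ≈0⇒≈ p i = x∙y⁻¹≈ε⇒x≈y _ _ (p i)

  lincomb-cong : ∀ {m n} {c d : Fin m → Carrier} {g h : Fin m → Vec n} →
    (∀ j → c j ≈ d j) → (∀ j → g j ≈ᵛ h j) → lincomb c g ≈ᵛ lincomb d h
  lincomb-cong c≈d g≈h i = sum-cong-≋ (λ j → *-cong (c≈d j) (g≈h j i))

  lincomb-coord : ∀ {m n n′} (c : Fin m → Carrier) {g : Fin m → Vec n} {h : Fin m → Vec n′} i i′ →
    (∀ j → g j i ≈ h j i′) → lincomb c g i ≈ lincomb c h i′
  lincomb-coord c i i′ p = sum-cong-≋ (λ j → *-congˡ (p j))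

  lincomb-coord-0 : ∀ {m n} (c : Fin m → Carrier) {g : Fin m → Vec n} i →
    (∀ j → g j i ≈ 0#) → lincomb c g i ≈ 0#
  lincomb-coord-0 {m} c i p =
    trans (sum-cong-≋ (λ j → trans (*-congˡ (p j)) (zeroʳ _))) (sum-replicate-zero m)

  lincomb-0 : ∀ {m n} {c : Fin m → Carrier} (g : Fin m → Vec n) →
    (∀ j → c j ≈ 0#) → lincomb c g ≈ᵛ 0ᵛ
  lincomb-0 {m} g c≈0 i =
    trans (sum-cong-≋ (λ j → trans (*-congʳ (c≈0 j)) (zeroˡ _))) (sum-replicate-zero m)

  lincomb-+ : ∀ {m n} (c d : Fin m → Carrier) (g : Fin m → Vec n) →
    lincomb (λ j → c j + d j) g ≈ᵛ lincomb c g +ᵛ lincomb d g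
  lincomb-+ c d g i = trans (sum-cong-≋ (λ j → distribʳ (g j i) (c j) (d j)))
                            (∑-distrib-+ (λ j → c j * g j i) (λ j → d j * g j i))

  lincomb-• : ∀ {m n} (a : Carrier) (c : Fin m → Carrier) (g : Fin m → Vec n) →
    lincomb (λ j → a * c j) g ≈ᵛ a • lincomb c g
  lincomb-• a c g i = trans (sum-cong-≋ (λ j → *-assoc a (c j) (g j i)))
                            (sym (*-distribˡ-sum a (λ j → c j * g j i)))

  lincomb-remove : ∀ {m n} (r : Fin (suc m)) (c : Fin (suc m) → Carrier) (g : Fin (suc m) → Vec n) →
    lincomb c g ≈ᵛ c r • g r +ᵛ lincomb (λ j → c (punchIn r j)) (λ j → g (punchIn r j))
  lincomb-remove r c g i = sum-remove {i = r} (λ j → c j * g j i)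

  -- Kronecker delta: the coefficient vector selecting one generator, and
  -- at the same time the standard basis of F_q^m.
  δ : ∀ {m} → Fin m → Fin m → Carrier
  δ zero    zero    = 1#
  δ zero    (suc j) = 0#
  δ (suc r) zero    = 0#
  δ (suc r) (suc j) = δ r j

  lincomb-δ : ∀ {m n} (r : Fin m) (g : Fin m → Vec n) → lincomb (δ r) g ≈ᵛ g r
  lincomb-δ zero g i = begin
    1# * g zero i + lincomb (λ _ → 0#) (tail g) i ≈⟨ +-cong (*-identityˡ _) (lincomb-0 (tail g) (λ _ → refl) i) ⟩
    g zero i + 0#                                 ≈⟨ +-identityʳ _ ⟩
    g zero i                                      ∎
  lincomb-δ (suc r) g i = begin
    0# * g zero i + lincomb (δ r) (tail g) i ≈⟨ +-cong (zeroˡ _) (lincomb-δ r (tail g) i) ⟩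
    0# + g (suc r) i                         ≈⟨ +-identityˡ _ ⟩
    g (suc r) i                              ∎

  lincomb-std : ∀ {m} (c : Vec m) → lincomb c δ ≈ᵛ c
  lincomb-std {suc m} c zero = begin
    c zero * 1# + lincomb (tail c) (λ j → δ (suc j)) zero
      ≈⟨ +-cong (*-identityʳ _) (lincomb-coord-0 (tail c) {λ j → δ (suc j)} zero (λ _ → refl)) ⟩
    c zero + 0# ≈⟨ +-identityʳ _ ⟩
    c zero      ∎
  lincomb-std {suc m} c (suc i) = begin
    c zero * 0# + lincomb (tail c) (λ j → δ (suc j)) (suc i) ≈⟨ +-cong (zeroʳ _) (lincomb-std (tail c) i) ⟩
    0# + c (suc i)                                          ≈⟨ +-identityˡ _ ⟩
    c (suc i)                                               ∎

  ∈-resp : ∀ {n} (U : Subspace n) {u v : Vec n} → u ≈ᵛ v → u ∈ U → v ∈ U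
  ∈-resp (span g) u≈v (c , p) = c , ≈ᵛ-trans (≈ᵛ-sym u≈v) p

  ∈-0 : ∀ {n} (U : Subspace n) → 0ᵛ ∈ U
  ∈-0 (span g) = (λ _ → 0#) , ≈ᵛ-sym (lincomb-0 g (λ _ → refl))

  ∈-+ : ∀ {n} (U : Subspace n) {u v : Vec n} → u ∈ U → v ∈ U → u +ᵛ v ∈ U
  ∈-+ (span g) (c , p) (d , r) =
    (λ j → c j + d j) , λ i → trans (+-cong (p i) (r i)) (sym (lincomb-+ c d g i))

  ∈-• : ∀ {n} (U : Subspace n) (a : Carrier) {u : Vec n} → u ∈ U → a • u ∈ U
  ∈-• (span g) a (c , p) =
    (λ j → a * c j) , λ i → trans (*-congˡ (p i)) (sym (lincomb-• a c g i))

  ∈--ᵛ : ∀ {n} (U : Subspace n) {u v : Vec n} → u ∈ U → v ∈ U → u -ᵛ v ∈ U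
  ∈--ᵛ U u∈U v∈U = ∈-+ U u∈U (∈-resp U (λ i → -1*x≈-x _) (∈-• U (- 1#) v∈U))

  ∈-•⁻¹ : ∀ {n} (U : Subspace n) {a : Carrier} {u : Vec n} → ¬ (a ≈ 0#) → a • u ∈ U → u ∈ U
  ∈-•⁻¹ U {a} {u} a≉0 au∈U with inverse a a≉0
  ... | b , ab≈1 = ∈-resp U (λ i → begin
    b * (a * u i) ≈⟨ sym (*-assoc b a (u i)) ⟩
    (b * a) * u i ≈⟨ *-congʳ (trans (*-comm b a) ab≈1) ⟩
    1# * u i      ≈⟨ *-identityˡ _ ⟩
    u i           ∎) (∈-• U b au∈U)

  ∈-gen : ∀ {m n} (g : Fin m → Vec n) (j : Fin m) → g j ∈ span g
  ∈-gen g j = δ j , ≈ᵛ-sym (lincomb-δ j g)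

  ∈-lincomb : ∀ {m n} (U : Subspace n) (c : Fin m → Carrier) (h : Fin m → Vec n) →
    (∀ j → h j ∈ U) → lincomb c h ∈ U
  ∈-lincomb {zero}  U c h h∈U = ∈-0 U
  ∈-lincomb {suc m} U c h h∈U =
    ∈-+ U (∈-• U (c zero) (h∈U zero)) (∈-lincomb U (tail c) (tail h) (λ j → h∈U (suc j)))

  span⊆ : ∀ {m n} {g : Fin m → Vec n} (W : Subspace n) → (∀ j → g j ∈ W) → span g ⊆ W
  span⊆ {g = g} W g∈W v (c , p) = ∈-resp W (≈ᵛ-sym p) (∈-lincomb W c g g∈W)

  span-cong : ∀ {m n} {g h : Fin m → Vec n} → (∀ j → g j ≈ᵛ h j) → span g ≐ span h
  span-cong {g = g} {h} g≈h =
    span⊆ (span h) (λ j → ∈-resp (span h) (≈ᵛ-sym (g≈h j)) (∈-gen h j)) ,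
    span⊆ (span g) (λ j → ∈-resp (span g) (g≈h j) (∈-gen g j))

  ⊆-refl : ∀ {n} {U : Subspace n} → U ⊆ U
  ⊆-refl v v∈U = v∈U

  ⊆-trans : ∀ {n} {U V W : Subspace n} → U ⊆ V → V ⊆ W → U ⊆ W
  ⊆-trans U⊆V V⊆W v v∈U = V⊆W v (U⊆V v v∈U)

  ≐-sym : ∀ {n} {U V : Subspace n} → U ≐ V → V ≐ U
  ≐-sym (U⊆V , V⊆U) = V⊆U , U⊆V

  ≐-trans : ∀ {n} {U V W : Subspace n} → U ≐ V → V ≐ W → U ≐ W
  ≐-trans (U⊆V , V⊆U) (V⊆W , W⊆V) = ⊆-trans U⊆V V⊆W , ⊆-trans W⊆V V⊆U

  +-minus-cancel : ∀ x y → x + (y - x) ≈ y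
  +-minus-cancel x y = begin
    x + (y - x)     ≈⟨ +-congˡ (+-comm y (- x)) ⟩
    x + (- x + y)   ≈⟨ sym (+-assoc x (- x) y) ⟩
    (x - x) + y     ≈⟨ +-congʳ (-‿inverseʳ x) ⟩
    0# + y          ≈⟨ +-identityˡ y ⟩
    y               ∎

  -- The last coordinate.  F_q^{m+1} = F_q^m × F_q: a vector v splits into
  -- init v (what puncturing keeps) and last v; w ∷ʳ a glues them back.

  infixl 30 _∷ʳ_
  _∷ʳ_ : ∀ {m} → Vec m → Carrier → Vec (suc m)
  _∷ʳ_ {zero}  w a = a ∷ []
  _∷ʳ_ {suc m} w a = head w ∷ (tail w ∷ʳ a)

  init-∷ʳ : ∀ {m} (w : Vec m) a j → init (w ∷ʳ a) j ≡ w j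
  init-∷ʳ {suc m} w a zero    = ≡.refl
  init-∷ʳ {suc m} w a (suc j) = init-∷ʳ (tail w) a j

  last-∷ʳ : ∀ {m} (w : Vec m) a → last (w ∷ʳ a) ≡ a
  last-∷ʳ {zero}  w a = ≡.refl
  last-∷ʳ {suc m} w a = last-∷ʳ (tail w) a

  init-last-≈ : ∀ {m} {u v : Vec (suc m)} → init u ≈ᵛ init v → last u ≈ last v → u ≈ᵛ v
  init-last-≈ {zero}  p l zero    = l
  init-last-≈ {suc m} p l zero    = p zero
  init-last-≈ {suc m} p l (suc i) = init-last-≈ {m} (λ j → p (suc j)) l i

  -- The last standard basis vector ê = (0,…,0,1): it spans the kernel of
  -- puncturing, and whether a subspace contains it governs everything below.
  ê : ∀ {m} → Vec (suc m)
  ê = 0ᵛ ∷ʳ 1#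

  init-ê : ∀ {m} (j : Fin m) → init ê j ≈ 0#
  init-ê j = reflexive (init-∷ʳ 0ᵛ 1# j)

  last-ê : ∀ {m} → last (ê {m}) ≈ 1#
  last-ê {m} = reflexive (last-∷ʳ {m} 0ᵛ 1#)

  ê≉0 : ∀ {m} → ¬ (ê {m} ≈ᵛ 0ᵛ)
  ê≉0 {m} ê≈0 = 1≉0 (trans (sym (last-ê {m})) (ê≈0 (fromℕ m)))

  init≈0⇒multiple-of-ê : ∀ {m} (v : Vec (suc m)) → init v ≈ᵛ 0ᵛ → v ≈ᵛ last v • ê
  init≈0⇒multiple-of-ê {m} v p = init-last-≈
    (λ j → trans (p j) (sym (trans (*-congˡ (init-ê j)) (zeroʳ _))))
    (sym (trans (*-congˡ (last-ê {m})) (*-identityʳ _)))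

  init≈0-dichotomy : ∀ {m} (U : Subspace (suc m)) {v} → v ∈ U → init v ≈ᵛ 0ᵛ → v ≈ᵛ 0ᵛ ⊎ ê ∈ U
  init≈0-dichotomy U {v} v∈U p with last v ≟ 0#
  ... | yes l≈0 = inj₁ (λ i → trans (init≈0⇒multiple-of-ê v p i) (trans (*-congʳ l≈0) (zeroˡ _)))
  ... | no  l≉0 = inj₂ (∈-•⁻¹ U l≉0 (∈-resp U (init≈0⇒multiple-of-ê v p) v∈U))

  init-≈⇒init-diff≈0 : ∀ {m} (u v : Vec (suc m)) → init u ≈ᵛ init v → init (u -ᵛ v) ≈ᵛ 0ᵛ
  init-≈⇒init-diff≈0 u v p j = trans (+-congˡ (-‿cong (sym (p j)))) (-‿inverseʳ _)

  ∈-puncture : ∀ {m} (U : Subspace (suc m)) {v} → v ∈ U → init v ∈ puncture U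
  ∈-puncture (span g) (c , p) = c , λ i → p (inject₁ i)

  puncture-preimage : ∀ {m} (U : Subspace (suc m)) {w} → w ∈ puncture U → ∃ λ v → v ∈ U × init v ≈ᵛ w
  puncture-preimage (span g) (c , p) = lincomb c g , (c , λ _ → refl) , ≈ᵛ-sym p

  puncture-mono : ∀ {m} {U W : Subspace (suc m)} → U ⊆ W → puncture U ⊆ puncture W
  puncture-mono {U = U} {W} U⊆W w w∈pU with puncture-preimage U w∈pU
  ... | v , v∈U , initv≈w = ∈-resp (puncture W) initv≈w (∈-puncture W (U⊆W v v∈U))

  puncture-cong : ∀ {m} {U W : Subspace (suc m)} → U ≐ W → puncture U ≐ puncture W
  puncture-cong (U⊆W , W⊆U) = puncture-mono U⊆W , puncture-mono W⊆U

  puncture-reflects-⊆ : ∀ {m} {V X Y : Subspace (suc m)} → ¬ (ê ∈ V) → X ⊆ V → Y ⊆ V →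
    puncture X ⊆ puncture Y → X ⊆ Y
  puncture-reflects-⊆ {V = V} {X} {Y} ê∉V X⊆V Y⊆V pX⊆pY x x∈X
    with puncture-preimage Y (pX⊆pY (init x) (∈-puncture X x∈X))
  ... | y , y∈Y , inity≈initx
    with init≈0-dichotomy V (∈--ᵛ V (X⊆V x x∈X) (Y⊆V y y∈Y)) (init-≈⇒init-diff≈0 x y (≈ᵛ-sym inity≈initx))
  ... | inj₁ x-y≈0 = ∈-resp Y (≈ᵛ-sym (-ᵛ≈0⇒≈ x-y≈0)) y∈Y
  ... | inj₂ ê∈V   = ⊥-elim (ê∉V ê∈V)

  ∈-from-puncture : ∀ {m} (U : Subspace (suc m)) {v} → ê ∈ U → init v ∈ puncture U → v ∈ U
  ∈-from-puncture U {v} ê∈U initv∈pU with puncture-preimage U initv∈pU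
  ... | u , u∈U , initu≈initv = ∈-resp U (λ i → +-minus-cancel (u i) (v i))
    (∈-+ U u∈U (∈-resp U (≈ᵛ-sym (init≈0⇒multiple-of-ê (v -ᵛ u) (init-≈⇒init-diff≈0 v u (≈ᵛ-sym initu≈initv))))
                         (∈-• U _ ê∈U)))

  puncture-reflects-⊆-ê : ∀ {m} (U W : Subspace (suc m)) → ê ∈ W → puncture U ⊆ puncture W → U ⊆ W
  puncture-reflects-⊆-ê U W ê∈W pU⊆pW u u∈U =
    ∈-from-puncture W ê∈W (pU⊆pW (init u) (∈-puncture U u∈U))

  LinIndep-∷ : ∀ {t n} {x : Vec n} {G : Fin t → Vec n} → LinIndep G → ¬ (x ∈ span G) → LinIndep (x ∷ G)
  LinIndep-∷ {x = x} {G} ind x∉G c Σ≈0 = λ { zero → c₀≈0 ; (suc j) → ind (tail c) tail≈0 j }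
    where
    -- Σ≈0 i : c₀ * x i + lincomb (tail c) G i ≈ 0#
    c₀≈0 : c zero ≈ 0#
    c₀≈0 with c zero ≟ 0#
    ... | yes c₀≈0 = c₀≈0
    ... | no  c₀≉0 = ⊥-elim (x∉G (∈-•⁻¹ (span G) c₀≉0 (∈-resp (span G)
            (λ i → trans (-1*x≈-x _) (sym (inverseˡ-unique _ _ (Σ≈0 i))))
            (∈-• (span G) (- 1#) (tail c , λ _ → refl)))))
    tail≈0 : lincomb (tail c) G ≈ᵛ 0ᵛ
    tail≈0 i = begin
      lincomb (tail c) G i                        ≈⟨ sym (+-identityˡ _) ⟩
      0# + lincomb (tail c) G i                   ≈⟨ +-congʳ (sym (trans (*-congʳ c₀≈0) (zeroˡ _))) ⟩
      c zero * x i + lincomb (tail c) G i         ≈⟨ Σ≈0 i ⟩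
      0#                                          ∎

  -- Every
  -- subspace W with ê ∉ W and puncture W = ⟨β⟩ is one of the q^t lifts.

  lift : ∀ {m t} → (Fin t → Vec m) → (Fin t → Carrier) → Subspace (suc m)
  lift β c = span (λ r → β r ∷ʳ c r)

  init-lincomb-∷ʳ : ∀ {t m} (a : Fin t → Carrier) (β : Fin t → Vec m) (c : Fin t → Carrier) →
    init (lincomb a (λ r → β r ∷ʳ c r)) ≈ᵛ lincomb a β
  init-lincomb-∷ʳ a β c i = lincomb-coord a {λ r → β r ∷ʳ c r} {β} (inject₁ i) i (λ r → reflexive (init-∷ʳ (β r) (c r) i))

  puncture-lift : ∀ {m t} (β : Fin t → Vec m) (c : Fin t → Carrier) → puncture (lift β c) ≐ span β
  puncture-lift β c = span-cong (λ r i → reflexive (init-∷ʳ (β r) (c r) i))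

  lift-cong : ∀ {m t} (β : Fin t → Vec m) {c c′} → (∀ r → c r ≈ c′ r) → lift β c ≐ lift β c′
  lift-cong β c≈c′ = span-cong (λ r → init-last-≈
    (λ i → reflexive (≡.trans (init-∷ʳ (β r) _ i) (≡.sym (init-∷ʳ (β r) _ i))))
    (trans (reflexive (last-∷ʳ (β r) _)) (trans (c≈c′ r) (reflexive (≡.sym (last-∷ʳ (β r) _))))))

  lift-indep : ∀ {m t} (β : Fin t → Vec m) (c : Fin t → Carrier) → LinIndep β → LinIndep (λ r → β r ∷ʳ c r)
  lift-indep β c ind a Σ≈0 = ind a (λ i → trans (sym (init-lincomb-∷ʳ a β c i)) (Σ≈0 (inject₁ i)))

  lift-dim : ∀ {m t} (β : Fin t → Vec m) (c : Fin t → Carrier) → LinIndep β → HasDim (lift β c) t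
  lift-dim β c ind = (λ r → β r ∷ʳ c r) , lift-indep β c ind , ⊆-refl , ⊆-refl

  ê∉lift : ∀ {m t} (β : Fin t → Vec m) (c : Fin t → Carrier) → LinIndep β → ¬ (ê ∈ lift β c)
  ê∉lift β c ind (a , ê≈Σ) = ê≉0 (≈ᵛ-trans ê≈Σ (lincomb-0 (λ r → β r ∷ʳ c r) a≈0))
    where
    a≈0 : ∀ r → a r ≈ 0#
    a≈0 = ind a (λ i → trans (sym (init-lincomb-∷ʳ a β c i)) (trans (sym (ê≈Σ (inject₁ i))) (init-ê i)))

  lift-exists : ∀ {m t} (β : Fin t → Vec m) (W : Subspace (suc m)) → span β ⊆ puncture W →
    ∃ λ c → lift β c ⊆ W
  lift-exists β W β⊆pW = (λ r → last (preimage r)) , span⊆ W (λ r → ∈-resp W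
      (init-last-≈ (λ i → trans (proj₂ (proj₂ (P r)) i) (sym (reflexive (init-∷ʳ (β r) _ i))))
                   (sym (reflexive (last-∷ʳ (β r) _))))
      (proj₁ (proj₂ (P r))))
    where
    P : ∀ r → ∃ λ v → v ∈ W × init v ≈ᵛ β r
    P r = puncture-preimage W (β⊆pW (β r) (∈-gen β r))
    preimage : ∀ r → Vec _
    preimage r = proj₁ (P r)

  lift⊆ : ∀ {m t} (β : Fin t → Vec m) (c : Fin t → Carrier) (U : Subspace (suc m)) →
    ê ∈ U → span β ⊆ puncture U → lift β c ⊆ U
  lift⊆ β c U ê∈U β⊆pU = span⊆ U (λ r → ∈-from-puncture U ê∈U
    (∈-resp (puncture U) (λ i → sym (reflexive (init-∷ʳ (β r) (c r) i))) (β⊆pU (β r) (∈-gen β r))))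

  lift-diff : ∀ {m t} (β : Fin t → Vec m) {c c′} (W : Subspace (suc m)) r →
    lift β c ⊆ W → lift β c′ ⊆ W → ¬ (c r ≈ c′ r) → ê ∈ W
  lift-diff β {c} {c′} W r c⊆W c′⊆W cr≉c′r =
    ∈-•⁻¹ W last-diff≉0 (∈-resp W (init≈0⇒multiple-of-ê diff init-diff≈0)
      (∈--ᵛ W (c⊆W _ (∈-gen _ r)) (c′⊆W _ (∈-gen _ r))))
    where
    diff = (β r ∷ʳ c r) -ᵛ (β r ∷ʳ c′ r)
    init-diff≈0 : init diff ≈ᵛ 0ᵛ
    init-diff≈0 = init-≈⇒init-diff≈0 (β r ∷ʳ c r) (β r ∷ʳ c′ r)
      (λ i → reflexive (≡.trans (init-∷ʳ (β r) _ i) (≡.sym (init-∷ʳ (β r) _ i))))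
    last-diff≉0 : ¬ (last diff ≈ 0#)
    last-diff≉0 p = cr≉c′r (x∙y⁻¹≈ε⇒x≈y _ _
      (trans (sym (+-cong (reflexive (last-∷ʳ (β r) _)) (-‿cong (reflexive (last-∷ʳ (β r) _))))) p))

  -- The cone  hat T = T ⊕ ⟨ê⟩ over a subspace T of F_q^m: the unique
  -- subspace of F_q^{m+1} containing ê and puncturing to T.

  hat : ∀ {m} → Subspace m → Subspace (suc m)
  hat (span g) = span (ê ∷ λ r → g r ∷ʳ 0#)

  ê∈hat : ∀ {m} (T : Subspace m) → ê ∈ hat T
  ê∈hat (span g) = ∈-gen (ê ∷ λ r → g r ∷ʳ 0#) zero

  puncture-hat : ∀ {m} (T : Subspace m) → puncture (hat T) ≐ T
  puncture-hat (span g) = span⊆ (span g) gen⊆ , span⊆ (puncture (hat (span g))) gen⊇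
    where
    gen⊆ : ∀ j → init ((ê ∷ λ r → g r ∷ʳ 0#) j) ∈ span g
    gen⊆ zero    = ∈-resp (span g) (λ i → sym (init-ê i)) (∈-0 (span g))
    gen⊆ (suc j) = ∈-resp (span g) (λ i → sym (reflexive (init-∷ʳ (g j) 0# i))) (∈-gen g j)
    gen⊇ : ∀ j → g j ∈ puncture (hat (span g))
    gen⊇ j = ∈-resp (puncture (hat (span g))) (λ i → reflexive (init-∷ʳ (g j) 0# i))
                    (∈-gen (λ r → init ((ê ∷ λ r → g r ∷ʳ 0#) r)) (suc j))

  hat⊆ : ∀ {m} (T : Subspace m) {U : Subspace (suc m)} → ê ∈ U → T ⊆ puncture U → hat T ⊆ U
  hat⊆ T {U} ê∈U T⊆pU =
    puncture-reflects-⊆-ê (hat T) U ê∈U (⊆-trans {U = puncture (hat T)} {T} {puncture U} (proj₁ (puncture-hat T)) T⊆pU)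

  ≐hat-puncture : ∀ {m} {U : Subspace (suc m)} → ê ∈ U → U ≐ hat (puncture U)
  ≐hat-puncture {U = U} ê∈U =
    puncture-reflects-⊆-ê U (hat (puncture U)) (ê∈hat (puncture U)) (proj₂ (puncture-hat (puncture U))) ,
    hat⊆ (puncture U) ê∈U ⊆-refl

  hat-cong : ∀ {m} {T T′ : Subspace m} → T ≐ T′ → hat T ≐ hat T′
  hat-cong {T = T} {T′} (T⊆T′ , T′⊆T) =
    hat⊆ T {hat T′} (ê∈hat T′) (⊆-trans {U = T} {T′} {puncture (hat T′)} T⊆T′ (proj₂ (puncture-hat T′))) ,
    hat⊆ T′ {hat T} (ê∈hat T) (⊆-trans {U = T′} {T} {puncture (hat T)} T′⊆T (proj₂ (puncture-hat T)))

  hat-dim : ∀ {m s} {T : Subspace m} → HasDim T s → HasDim (hat T) (suc s)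
  hat-dim (β , ind , β≐T) =
    (ê ∷ λ r → β r ∷ʳ 0#) , LinIndep-∷ (lift-indep β _ ind) (ê∉lift β _ ind) , hat-cong β≐T

  -- Finiteness: coefficient vectors F_q^t are enumerated by Fin (q^t);
  -- hence membership in a subspace is decidable.

  coeffs : ∀ t → Fin (q ℕ.^ t) → Fin t → Carrier
  coeffs zero    i ()
  coeffs (suc t) i = Inverse.from card (proj₁ (remQuot {q} (q ℕ.^ t) i)) ∷ coeffs t (proj₂ (remQuot {q} (q ℕ.^ t) i))

  coeffs-surjective : ∀ t (c : Fin t → Carrier) → ∃ λ i → ∀ r → coeffs t i r ≈ c r
  coeffs-surjective zero    c = zero , λ ()
  coeffs-surjective (suc t) c with coeffs-surjective t (tail c)
  ... | i , p = combine (Inverse.to card (c zero)) i , λ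
    { zero    → trans (reflexive (≡.cong (λ x → Inverse.from card (proj₁ x)) split))
                      (Inverse.strictlyInverseʳ card (c zero))
    ; (suc r) → trans (reflexive (≡.cong (λ x → coeffs t (proj₂ x) r) split)) (p r) }
    where
    split = Finₚ.remQuot-combine {k = q ℕ.^ t} (Inverse.to card (c zero)) i

  coeffs-injective : ∀ t (i j : Fin (q ℕ.^ t)) → (∀ r → coeffs t i r ≈ coeffs t j r) → i ≡ j
  coeffs-injective zero    zero zero p = ≡.refl
  coeffs-injective (suc t) i    j    p =
    ≡.trans (≡.sym (Finₚ.combine-remQuot {n = q} (q ℕ.^ t) i))
      (≡.trans (≡.cong₂ combine same-head same-tail) (Finₚ.combine-remQuot {n = q} (q ℕ.^ t) j))
    where
    same-head : proj₁ (remQuot {q} (q ℕ.^ t) i) ≡ proj₁ (remQuot {q} (q ℕ.^ t) j)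
    same-head = ≡.trans (≡.sym (Inverse.strictlyInverseˡ card _))
                  (≡.trans (Inverse.to-cong card (p zero)) (Inverse.strictlyInverseˡ card _))
    same-tail : proj₂ (remQuot {q} (q ℕ.^ t) i) ≡ proj₂ (remQuot {q} (q ℕ.^ t) j)
    same-tail = coeffs-injective t _ _ (λ r → p (suc r))

  _≈ᵛ?_ : ∀ {n} (u v : Vec n) → Dec (u ≈ᵛ v)
  u ≈ᵛ? v = Finₚ.all? (λ i → u i ≟ v i)

  _∈?_ : ∀ {n} (v : Vec n) (U : Subspace n) → Dec (v ∈ U)
  v ∈? span {k} g with Finₚ.any? (λ i → v ≈ᵛ? lincomb (coeffs k i) g)
  ... | yes (i , p) = yes (coeffs k i , p)
  ... | no  ¬p      = no λ (c , p) → let i , i≈c = coeffs-surjective k c in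
                        ¬p (i , ≈ᵛ-trans p (lincomb-cong (λ r → sym (i≈c r)) (λ _ _ → refl)))

  ≉⇒differ-at : ∀ {t} (c c′ : Fin t → Carrier) → ¬ (∀ r → c r ≈ c′ r) → ∃ λ r → ¬ (c r ≈ c′ r)
  ≉⇒differ-at {t} c c′ = Finₚ.¬∀⟶∃¬ t _ (λ r → c r ≟ c′ r)

  -- Dimension under puncturing: it is kept when ê ∉ U and drops by one
  -- when ê ∈ U.  Consequently dimension is well defined.

  dim-puncture-ê∉ : ∀ {m d} {U : Subspace (suc m)} → ¬ (ê ∈ U) → HasDim U d → HasDim (puncture U) d
  dim-puncture-ê∉ {U = U} ê∉U (β , ind , β⊆U , U⊆β) =
    (λ r → init (β r)) , indep , puncture-cong {U = span β} {U} (β⊆U , U⊆β)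
    where
    indep : LinIndep (λ r → init (β r))
    indep a Σ≈0 with init≈0-dichotomy U (β⊆U _ (a , λ _ → refl)) Σ≈0
    ... | inj₁ Σβ≈0 = ind a Σβ≈0
    ... | inj₂ ê∈U  = ⊥-elim (ê∉U ê∈U)

  -- Exchange argument: if ê = Σ a_k β_k for a basis β with a_r ≠ 0, then
  -- the init of the β_k with k ≠ r form a basis of the puncturing of ⟨β⟩.
  module PunctureExchange {m s} (β : Fin (suc s) → Vec (suc m)) (ind : LinIndep β)
    (a : Fin (suc s) → Carrier) (ê≈Σ : ê ≈ᵛ lincomb a β) (r : Fin (suc s)) (ar≉0 : ¬ (a r ≈ 0#)) where

    β′ : Fin s → Vec (suc m)
    β′ j = β (punchIn r j)

    γ : Fin s → Vec m
    γ j = init (β′ j)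

    a′ : Fin s → Carrier
    a′ j = a (punchIn r j)

    -- init ê = 0 expresses init β_r through the γ_j.
    init-βr∈γ : init (β r) ∈ span γ
    init-βr∈γ = ∈-•⁻¹ (span γ) ar≉0 (∈-resp (span γ)
      (λ j → trans (-1*x≈-x _) (sym (inverseˡ-unique _ _ (relation j))))
      (∈-• (span γ) (- 1#) (∈-lincomb (span γ) a′ γ (∈-gen γ))))
      where
      relation : ∀ j → a r * init (β r) j + lincomb a′ γ j ≈ 0#
      relation j = trans (sym (lincomb-remove r a β (inject₁ j))) (trans (sym (ê≈Σ (inject₁ j))) (init-ê j))

    γ-span : span γ ≐ span (λ k → init (β k))
    γ-span = span⊆ (span (λ k → init (β k))) (λ j → ∈-gen (λ k → init (β k)) (punchIn r j)) ,
             span⊆ (span γ) γ-gen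
      where
      γ-gen : ∀ k → init (β k) ∈ span γ
      γ-gen k with k Finₚ.≟ r
      ... | yes ≡.refl = init-βr∈γ
      ... | no  k≢r    = ≡.subst (λ x → init (β x) ∈ span γ) (Finₚ.punchIn-punchOut (k≢r ∘ ≡.sym))
                           (∈-gen γ (punchOut (k≢r ∘ ≡.sym)))

    -- If Σ c_j γ_j = 0, then v = Σ c_j β′_j = λ ê = λ Σ a_k β_k, and
    -- independence of β makes every coefficient of v - λ Σ a_k β_k vanish.
    γ-indep : LinIndep γ
    γ-indep c Σ≈0 j = begin
      c j                           ≈⟨ sym (+-identityʳ _) ⟩
      c j + 0#                      ≈⟨ +-cong (sym (reflexive (Vecₚ.insertAt-punchIn c r 0# j)))
                                              (sym (trans (*-congʳ -λ≈0) (zeroˡ _))) ⟩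
      d (punchIn r j)               ≈⟨ d≈0 (punchIn r j) ⟩
      0#                            ∎
      where
      v = lincomb c β′
      λv = last v
      d : Fin (suc s) → Carrier
      d k = insertAt c r 0# k + (- λv) * a k
      Σdβ≈0 : lincomb d β ≈ᵛ 0ᵛ
      Σdβ≈0 i = begin
        lincomb d β i
          ≈⟨ lincomb-+ (insertAt c r 0#) (λ k → (- λv) * a k) β i ⟩
        lincomb (insertAt c r 0#) β i + lincomb (λ k → (- λv) * a k) β i
          ≈⟨ +-cong (lincomb-remove r (insertAt c r 0#) β i) (lincomb-• (- λv) a β i) ⟩
        (insertAt c r 0# r * β r i + lincomb (λ j → insertAt c r 0# (punchIn r j)) β′ i) + (- λv) * lincomb a β i
          ≈⟨ +-cong (+-cong (trans (*-congʳ (reflexive (Vecₚ.insertAt-lookup c r 0#))) (zeroˡ _))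
                            (lincomb-cong {g = β′} (λ j → reflexive (Vecₚ.insertAt-punchIn c r 0# j)) (λ _ _ → refl) i))
                    (*-congˡ (sym (ê≈Σ i))) ⟩
        (0# + v i) + (- λv) * ê i
          ≈⟨ +-cong (trans (+-identityˡ _) (init≈0⇒multiple-of-ê v Σ≈0 i)) refl ⟩
        λv * ê i + (- λv) * ê i ≈⟨ sym (distribʳ _ _ _) ⟩
        (λv - λv) * ê i         ≈⟨ *-congʳ (-‿inverseʳ _) ⟩
        0# * ê i                ≈⟨ zeroˡ _ ⟩
        0#                      ∎
      d≈0 = ind d Σdβ≈0
      -λ≈0 : - λv ≈ 0#
      -λ≈0 with inverse (a r) ar≉0
      ... | b , ab≈1 = begin
        - λv                ≈⟨ sym (*-identityʳ _) ⟩
        - λv * 1#           ≈⟨ *-congˡ (sym ab≈1) ⟩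
        - λv * (a r * b)    ≈⟨ sym (*-assoc _ _ _) ⟩
        (- λv * a r) * b    ≈⟨ *-congʳ (trans (sym (+-identityˡ _))
                                 (trans (+-congʳ (sym (reflexive (Vecₚ.insertAt-lookup c r 0#)))) (d≈0 r))) ⟩
        0# * b              ≈⟨ zeroˡ _ ⟩
        0#                  ∎

  dim-puncture-ê∈ : ∀ {m s} {U : Subspace (suc m)} → ê ∈ U → HasDim U (suc s) → HasDim (puncture U) s
  dim-puncture-ê∈ {U = U} ê∈U (β , ind , β⊆U , U⊆β) with U⊆β ê ê∈U
  ... | a , ê≈Σ with Finₚ.any? (λ r → ¬? (a r ≟ 0#))
  ... | no all-zero = ⊥-elim (ê≉0 (≈ᵛ-trans ê≈Σ (lincomb-0 β (λ r → decidable-stable (a r ≟ 0#) (λ ar≉0 → all-zero (r , ar≉0))))))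
  ... | yes (r , ar≉0) = γ , γ-indep , ≐-trans {U = span γ} {span (λ k → init (β k))} γ-span (puncture-cong {U = span β} {U} (β⊆U , U⊆β))
    where open PunctureExchange β ind a ê≈Σ r ar≉0

  dim0⇒ê∉ : ∀ {m} {U : Subspace (suc m)} → HasDim U 0 → ¬ (ê ∈ U)
  dim0⇒ê∉ (_ , _ , _ , U⊆β) ê∈U = ê≉0 (proj₂ (U⊆β ê ê∈U))

  dim-F0 : ∀ {d} {U : Subspace 0} → ¬ HasDim U (suc d)
  dim-F0 (_ , ind , _) = 1≉0 (ind (λ _ → 1#) (λ ()) zero)

  dim-unique : ∀ {m} (U : Subspace m) {d d′} → HasDim U d → HasDim U d′ → d ≡ d′
  dim-unique {zero}  U {zero}  {zero}   h h′ = ≡.refl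
  dim-unique {zero}  U {suc d}          h h′ = ⊥-elim (dim-F0 {U = U} h)
  dim-unique {zero}  U {zero}  {suc d′} h h′ = ⊥-elim (dim-F0 {U = U} h′)
  dim-unique {suc m} U {d} {d′} h h′ with ê ∈? U
  ... | no ê∉U = dim-unique (puncture U) (dim-puncture-ê∉ {U = U} ê∉U h) (dim-puncture-ê∉ {U = U} ê∉U h′)
  ... | yes ê∈U = unique-ê∈ d d′ h h′
    where
    unique-ê∈ : ∀ d d′ → HasDim U d → HasDim U d′ → d ≡ d′
    unique-ê∈ zero    _        h h′ = ⊥-elim (dim0⇒ê∉ {U = U} h ê∈U)
    unique-ê∈ (suc _) zero     h h′ = ⊥-elim (dim0⇒ê∉ {U = U} h′ ê∈U)
    unique-ê∈ (suc s) (suc s′) h h′ =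
      ≡.cong suc (dim-unique (puncture U) (dim-puncture-ê∈ {U = U} ê∈U h) (dim-puncture-ê∈ {U = U} ê∈U h′))

  record Enumeration {m} (V : Subspace m) (s : ℕ) (I : Set) : Set where
    field
      E        : I → Subspace m
      dimE     : ∀ i → HasDim (E i) s
      E⊆V      : ∀ i → E i ⊆ V
      distinct : ∀ i j → E i ≐ E j → i ≡ j
      complete : ∀ W → HasDim W s → W ⊆ V → ∃ λ i → W ≐ E i

  reindex : ∀ {m} {V : Subspace m} {s} {I J : Set} → J ↔ I → Enumeration V s I → Enumeration V s J
  reindex {V = V} {s} {I} {J} J↔I enum = record
    { E        = λ j → E (to j)
    ; dimE     = λ j → dimE (to j)
    ; E⊆V      = λ j → E⊆V (to j)
    ; distinct = λ j j′ Ej≐Ej′ → ≡.trans (≡.sym (strictlyInverseʳ j))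
                   (≡.trans (≡.cong from (distinct _ _ Ej≐Ej′)) (strictlyInverseʳ j′))
    ; complete = λ W dimW W⊆V → let i , W≐Ei = complete W dimW W⊆V in
                   from i , ≡.subst (λ i′ → W ≐ E i′) (≡.sym (strictlyInverseˡ i)) W≐Ei
    }
    where
    open Enumeration enum
    open Inverse J↔I

  -- Matching each listed subspace with its place in a second enumeration
  -- is injective; in particular two finite enumerations have equal size.
  enumeration-size-unique : ∀ {m} {V : Subspace m} {s c c′} →
    Enumeration V s (Fin c) → Enumeration V s (Fin c′) → c ≡ c′
  enumeration-size-unique {V = V} {s} A B = Finₚ.cantor-schröder-bernstein (match-injective A B) (match-injective B A)
    where
    match : ∀ {c c′} → Enumeration V s (Fin c) → Enumeration V s (Fin c′) → Fin c → Fin c′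
    match A B i = proj₁ (Enumeration.complete B (Enumeration.E A i) (Enumeration.dimE A i) (Enumeration.E⊆V A i))
    match-injective : ∀ {c c′} (A : Enumeration V s (Fin c)) (B : Enumeration V s (Fin c′)) → Injective _≡_ _≡_ (match A B)
    match-injective A B {i} {j} eq = Enumeration.distinct A i j
      (≐-trans {U = Enumeration.E A i} Ai≐B (≡.subst (λ k → Enumeration.E B k ≐ Enumeration.E A j) (≡.sym eq)
        (≐-sym {U = Enumeration.E A j} Aj≐B)))
      where
      Ai≐B = proj₂ (Enumeration.complete B (Enumeration.E A i) (Enumeration.dimE A i) (Enumeration.E⊆V A i))
      Aj≐B = proj₂ (Enumeration.complete B (Enumeration.E A j) (Enumeration.dimE A j) (Enumeration.E⊆V A j))

  -- Recursion step when ê ∈ V: an (s+1)-subspace W ⊆ V either contains ê,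
  -- and then W = hat T for an s-subspace T of puncture V, or it does not,
  -- and then W is one of the q^{s+1} lifts of an (s+1)-subspace of puncture V.
  module ConeStep {m s g₁ g₂} (V : Subspace (suc m)) (ê∈V : ê ∈ V)
    (E₁ : Enumeration (puncture V) s (Fin g₁)) (E₂ : Enumeration (puncture V) (suc s) (Fin g₂)) where

    private
      module E₁ = Enumeration E₁
      module E₂ = Enumeration E₂

    Q : ℕ
    Q = q ℕ.^ suc s

    β : Fin g₂ → Fin (suc s) → Vec m
    β x = proj₁ (E₂.dimE x)

    β-indep : ∀ x → LinIndep (β x)
    β-indep x = proj₁ (proj₂ (E₂.dimE x))

    β≐ : ∀ x → span (β x) ≐ E₂.E x
    β≐ x = proj₂ (proj₂ (E₂.dimE x))

    L : Fin Q → Fin g₂ → Subspace (suc m)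
    L a x = lift (β x) (coeffs (suc s) a)

    puncture-L : ∀ a x → puncture (L a x) ≐ E₂.E x
    puncture-L a x = ≐-trans {U = puncture (L a x)} {span (β x)} (puncture-lift (β x) (coeffs (suc s) a)) (β≐ x)

    ê∉L : ∀ a x → ¬ (ê ∈ L a x)
    ê∉L a x = ê∉lift (β x) (coeffs (suc s) a) (β-indep x)

    -- A lift determines its coefficient vector: two different lifts of the
    -- same basis inside one subspace would put ê into it.
    L-coeffs-injective : ∀ x a a′ → L a x ⊆ L a′ x → a ≡ a′
    L-coeffs-injective x a a′ La⊆La′ = by-cases (coeffs (suc s) a ≈ᵛ? coeffs (suc s) a′)
      where
      by-cases : Dec (coeffs (suc s) a ≈ᵛ coeffs (suc s) a′) → a ≡ a′
      by-cases (yes same)  = coeffs-injective (suc s) a a′ same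
      by-cases (no differ) = ⊥-elim (ê∉L a′ x (lift-diff (β x) {coeffs (suc s) a} {coeffs (suc s) a′} (L a′ x) r La⊆La′ (⊆-refl {U = L a′ x}) cr≉c′r))
        where
        r = proj₁ (≉⇒differ-at (coeffs (suc s) a) (coeffs (suc s) a′) differ)
        cr≉c′r = proj₂ (≉⇒differ-at (coeffs (suc s) a) (coeffs (suc s) a′) differ)

    L-injective : ∀ a a′ x x′ → L a x ≐ L a′ x′ → a ≡ a′ × x ≡ x′
    L-injective a a′ x x′ La≐La′ =
      L-coeffs-injective x a a′ (proj₁ (≡.subst (λ y → L a x ≐ L a′ y) (≡.sym x≡x′) La≐La′)) , x≡x′
      where
      x≡x′ : x ≡ x′
      x≡x′ = E₂.distinct x x′ (≐-trans {U = E₂.E x} {puncture (L a x)}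
        (≐-sym {U = puncture (L a x)} (puncture-L a x))
        (≐-trans {U = puncture (L a x)} {puncture (L a′ x′)} (puncture-cong {U = L a x} {L a′ x′} La≐La′) (puncture-L a′ x′)))

    E : Fin g₁ ⊎ (Fin Q × Fin g₂) → Subspace (suc m)
    E (inj₁ x)       = hat (E₁.E x)
    E (inj₂ (a , x)) = L a x

    distinct : ∀ i j → E i ≐ E j → i ≡ j
    distinct (inj₁ x) (inj₁ y) Ex≐Ey = ≡.cong inj₁ (E₁.distinct x y
      (≐-trans {U = E₁.E x} {puncture (hat (E₁.E x))} (≐-sym {U = puncture (hat (E₁.E x))} (puncture-hat (E₁.E x)))
        (≐-trans {U = puncture (hat (E₁.E x))} {puncture (hat (E₁.E y))}
          (puncture-cong {U = hat (E₁.E x)} {hat (E₁.E y)} Ex≐Ey) (puncture-hat (E₁.E y)))))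
    distinct (inj₁ x) (inj₂ (a , y)) Ex≐Ey = ⊥-elim (ê∉L a y (proj₁ Ex≐Ey ê (ê∈hat (E₁.E x))))
    distinct (inj₂ (a , y)) (inj₁ x) Ey≐Ex = ⊥-elim (ê∉L a y (proj₂ Ey≐Ex ê (ê∈hat (E₁.E x))))
    distinct (inj₂ (a , x)) (inj₂ (a′ , x′)) La≐La′ =
      let a≡a′ , x≡x′ = L-injective a a′ x x′ La≐La′ in ≡.cong₂ (λ a x → inj₂ (a , x)) a≡a′ x≡x′

    complete : ∀ W → HasDim W (suc s) → W ⊆ V → ∃ λ i → W ≐ E i
    complete W dimW W⊆V with ê ∈? W
    ... | yes ê∈W =
      let x , pW≐E₁x = E₁.complete (puncture W) (dim-puncture-ê∈ {U = W} ê∈W dimW) (puncture-mono {U = W} {V} W⊆V)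
      in inj₁ x , ≐-trans {U = W} {hat (puncture W)} {hat (E₁.E x)} (≐hat-puncture {U = W} ê∈W) (hat-cong {T = puncture W} {E₁.E x} pW≐E₁x)
    ... | no ê∉W with E₂.complete (puncture W) (dim-puncture-ê∉ {U = W} ê∉W dimW) (puncture-mono {U = W} {V} W⊆V)
    ...   | x , pW≐E₂x with lift-exists (β x) W (⊆-trans {U = span (β x)} {E₂.E x} (proj₁ (β≐ x)) (proj₂ pW≐E₂x))
    ...     | c , Lc⊆W = let a , a≈c = coeffs-surjective (suc s) c in
      inj₂ (a , x) , ≐-trans {U = W} {lift (β x) c} {L a x} (W⊆Lc , Lc⊆W) (lift-cong (β x) {c} {coeffs (suc s) a} (λ r → sym (a≈c r)))
      where
      W⊆Lc : W ⊆ lift (β x) c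
      W⊆Lc = puncture-reflects-⊆ {V = W} {W} {lift (β x) c} ê∉W (⊆-refl {U = W}) Lc⊆W
        (⊆-trans {U = puncture W} {E₂.E x} {puncture (lift (β x) c)} (proj₁ pW≐E₂x)
          (⊆-trans {U = E₂.E x} {span (β x)} {puncture (lift (β x) c)} (proj₂ (β≐ x)) (proj₂ (puncture-lift (β x) c))))

    enumeration : Enumeration V (suc s) (Fin g₁ ⊎ (Fin Q × Fin g₂))
    enumeration = record
      { E        = E
      ; dimE     = λ { (inj₁ x) → hat-dim {T = E₁.E x} (E₁.dimE x)
                     ; (inj₂ (a , x)) → lift-dim (β x) (coeffs (suc s) a) (β-indep x) }
      ; E⊆V      = λ { (inj₁ x) → hat⊆ (E₁.E x) {V} ê∈V (E₁.E⊆V x)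
                     ; (inj₂ (a , x)) → lift⊆ (β x) (coeffs (suc s) a) V ê∈V (⊆-trans {U = span (β x)} {E₂.E x} (proj₁ (β≐ x)) (E₂.E⊆V x)) }
      ; distinct = distinct
      ; complete = complete
      }

  -- Recursion step when ê ∉ V: puncturing is a bijection from the
  -- (s+1)-subspaces of V to those of puncture V.
  module LiftStep {m s g} (V : Subspace (suc m)) (ê∉V : ¬ (ê ∈ V))
    (E′ : Enumeration (puncture V) (suc s) (Fin g)) where

    private
      module E′ = Enumeration E′

    β : Fin g → Fin (suc s) → Vec m
    β x = proj₁ (E′.dimE x)

    β≐ : ∀ x → span (β x) ≐ E′.E x
    β≐ x = proj₂ (proj₂ (E′.dimE x))

    lift-in-V : ∀ x → ∃ λ c → lift (β x) c ⊆ V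
    lift-in-V x = lift-exists (β x) V (⊆-trans {U = span (β x)} {E′.E x} (proj₁ (β≐ x)) (E′.E⊆V x))

    E : Fin g → Subspace (suc m)
    E x = lift (β x) (proj₁ (lift-in-V x))

    puncture-E : ∀ x → puncture (E x) ≐ E′.E x
    puncture-E x = ≐-trans {U = puncture (E x)} {span (β x)} (puncture-lift (β x) (proj₁ (lift-in-V x))) (β≐ x)

    enumeration : Enumeration V (suc s) (Fin g)
    enumeration = record
      { E        = E
      ; dimE     = λ x → lift-dim (β x) (proj₁ (lift-in-V x)) (proj₁ (proj₂ (E′.dimE x)))
      ; E⊆V      = λ x → proj₂ (lift-in-V x)
      ; distinct = λ x y Ex≐Ey → E′.distinct x y (≐-trans {U = E′.E x} {puncture (E x)}
                     (≐-sym {U = puncture (E x)} (puncture-E x))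
                     (≐-trans {U = puncture (E x)} {puncture (E y)} (puncture-cong {U = E x} {E y} Ex≐Ey) (puncture-E y)))
      ; complete = complete
      }
      where
      complete : ∀ W → HasDim W (suc s) → W ⊆ V → ∃ λ x → W ≐ E x
      complete W dimW W⊆V =
        let x , pW≐E′x = E′.complete (puncture W) (dim-puncture-ê∉ {U = W} (λ ê∈W → ê∉V (W⊆V ê ê∈W)) dimW)
                                     (puncture-mono {U = W} {V} W⊆V)
        in x , puncture-reflects-⊆ {V = V} {W} {E x} ê∉V W⊆V (proj₂ (lift-in-V x))
                 (⊆-trans {U = puncture W} {E′.E x} {puncture (E x)} (proj₁ pW≐E′x) (proj₂ (puncture-E x))) ,
               puncture-reflects-⊆ {V = V} {E x} {W} ê∉V (proj₂ (lift-in-V x)) W⊆V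
                 (⊆-trans {U = puncture (E x)} {E′.E x} {puncture W} (proj₁ (puncture-E x)) (proj₂ pW≐E′x))

  zero-subspace : ∀ {m} → Subspace m
  zero-subspace = span {gens = 0} (λ ())

  -- Fin ([d,s] + q^{s+1} [d,s+1]) indexes the two kinds of subspaces in ConeStep.
  cone-index : ∀ {g₁ Q g₂} → Fin (g₁ ℕ.+ Q ℕ.* g₂) ↔ (Fin g₁ ⊎ (Fin Q × Fin g₂))
  cone-index = (↔-id _ ⊎-↔ Finₚ.*↔×) ↔-∘ Finₚ.+↔⊎

  gaussian-count : ∀ m (V : Subspace m) d s → HasDim V d → Enumeration V s (Fin (gauss q d s))
  gaussian-count m V d zero _ = record
    { E        = λ _ → zero-subspace {m}
    ; dimE     = λ _ → (λ ()) , (λ _ _ ()) , ⊆-refl {U = zero-subspace {m}} , ⊆-refl {U = zero-subspace {m}}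
    ; E⊆V      = λ _ → span⊆ {g = λ ()} V (λ ())
    ; distinct = λ { zero zero _ → ≡.refl }
    ; complete = λ { W (β , _ , β≐W) _ →
                     zero , ≐-trans {U = W} {span β} {zero-subspace} (≐-sym {U = span β} β≐W) (span-cong {g = β} {λ ()} (λ ())) }
    }
  gaussian-count zero V (suc d) (suc s) dimV = ⊥-elim (dim-F0 {U = V} dimV)
  gaussian-count zero V zero    (suc s) dimV = record
    { E = λ () ; dimE = λ () ; E⊆V = λ () ; distinct = λ ()
    ; complete = λ W dimW _ → ⊥-elim (dim-F0 {U = W} dimW) }
  gaussian-count (suc m) V d (suc s) dimV with ê ∈? V
  gaussian-count (suc m) V zero    (suc s) dimV | yes ê∈V = ⊥-elim (dim0⇒ê∉ {U = V} dimV ê∈V)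
  gaussian-count (suc m) V (suc d) (suc s) dimV | yes ê∈V =
    reindex cone-index (ConeStep.enumeration V ê∈V (gaussian-count m (puncture V) d s dim-pV)
                                                   (gaussian-count m (puncture V) d (suc s) dim-pV))
    where dim-pV = dim-puncture-ê∈ {U = V} ê∈V dimV
  gaussian-count (suc m) V d (suc s) dimV | no ê∉V =
    LiftStep.enumeration V ê∉V (gaussian-count m (puncture V) d (suc s) (dim-puncture-ê∉ {U = V} ê∉V dimV))

  subspace-exists : ∀ {m} {V : Subspace m} {d s} → HasDim V d → s ℕ.≤ d → ∃ λ T → HasDim T s × T ⊆ V
  subspace-exists {m} {V} {d} {s} dimV s≤d = E first , dimE first , E⊆V first
    where
    open Enumeration (gaussian-count m V d s dimV)
    first = fromℕ< (gauss-positive q d s s≤d)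

  full : ∀ {m} → Subspace m
  full = span δ

  full-dim : ∀ {m} → HasDim (full {m}) m
  full-dim = δ , (λ c Σ≈0 i → trans (sym (lincomb-std c i)) (Σ≈0 i)) , ⊆-refl , ⊆-refl

  ⊆full : ∀ {m} (W : Subspace m) → W ⊆ full
  ⊆full W v _ = v , ≈ᵛ-sym (lincomb-std v)

  -- The s-subspaces of F_q^m are partitioned by the b blocks of an
  -- S_q(s,d,m), each block containing [d,s]_q of them.
  steiner-count : ∀ {m s d b} (S : Fin b → Subspace m) → IsSteiner s d m b S → b ℕ.* gauss q d s ≡ gauss q m s
  steiner-count {m} {s} {d} {b} S (dimS , unique-block) = enumeration-size-unique
    (reindex Finₚ.*↔× (record { E = E ; dimE = dimE ; E⊆V = λ _ → ⊆full _ ; distinct = distinct ; complete = complete }))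
    (gaussian-count m full m s full-dim)
    where
    module Block j = Enumeration (gaussian-count m (S j) d s (dimS j))
    E : Fin b × Fin (gauss q d s) → Subspace m
    E (j , r) = Block.E j r
    dimE : ∀ i → HasDim (E i) s
    dimE (j , r) = Block.dimE j r
    distinct : ∀ i i′ → E i ≐ E i′ → i ≡ i′
    distinct (j , r) (j′ , r′) Ejr≐Ej′r′ with unique-block (E (j , r)) (dimE (j , r))
    ... | i , _ , only-i with ≡.trans (only-i j (Block.E⊆V j r))
                                 (≡.sym (only-i j′ (⊆-trans {U = E (j , r)} (proj₁ Ejr≐Ej′r′) (Block.E⊆V j′ r′))))
    ... | ≡.refl = ≡.cong (j ,_) (Block.distinct j r r′ Ejr≐Ej′r′)
    complete : ∀ W → HasDim W s → W ⊆ full → ∃ λ i → W ≐ E i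
    complete W dimW _ with unique-block W dimW
    ... | j , W⊆Sj , _ = let r , W≐ = Block.complete j W dimW W⊆Sj in (j , r) , W≐

  module PuncturedSystem (t′ k′ n′ : ℕ) (t′≤k′ : t′ ℕ.≤ k′) (b : ℕ) (B : Fin b → Subspace (suc n′))
    (steiner : IsSteiner (suc t′) (suc k′) (suc n′) b B) where

    S′ : Fin b → Subspace n′
    S′ i = puncture (B i)

    dimB : ∀ i → HasDim (B i) (suc k′)
    dimB = proj₁ steiner

    block : ∀ U → HasDim U (suc t′) → Fin b
    block U dimU = proj₁ (proj₂ steiner U dimU)

    U⊆block : ∀ U (dimU : HasDim U (suc t′)) → U ⊆ B (block U dimU)
    U⊆block U dimU = proj₁ (proj₂ (proj₂ steiner U dimU))

    block-unique : ∀ U (dimU : HasDim U (suc t′)) i → U ⊆ B i → i ≡ block U dimU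
    block-unique U dimU = proj₂ (proj₂ (proj₂ steiner U dimU))

    through-ê : ∃ (HasCount b (λ i → ê ∈ B i))
    through-ê = decidable-count (λ i → ê ∈ B i) (λ i → ê ∈? B i)

    b̃ : ℕ
    b̃ = proj₁ through-ê

    e : Fin b̃ → Fin b
    e = proj₁ (proj₂ through-ê)

    e-injective : Injective _≡_ _≡_ e
    e-injective = proj₁ (proj₂ (proj₂ through-ê))

    ê∈Be : ∀ j → ê ∈ B (e j)
    ê∈Be = proj₁ (proj₂ (proj₂ (proj₂ through-ê)))

    e-hits : ∀ i → ê ∈ B i → ∃ λ j → e j ≡ i
    e-hits = proj₂ (proj₂ (proj₂ (proj₂ through-ê)))

    dim-S′-ê∈ : ∀ i → ê ∈ B i → HasDim (S′ i) k′
    dim-S′-ê∈ i ê∈Bi = dim-puncture-ê∈ {U = B i} ê∈Bi (dimB i)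

    dim-S′-ê∉ : ∀ i → ¬ (ê ∈ B i) → HasDim (S′ i) (suc k′)
    dim-S′-ê∉ i ê∉Bi = dim-puncture-ê∉ {U = B i} ê∉Bi (dimB i)

    S′-small⇒ê∈ : ∀ i → HasDim (S′ i) k′ → ê ∈ B i
    S′-small⇒ê∈ i dim-k′ with ê ∈? B i
    ... | yes ê∈Bi = ê∈Bi
    ... | no  ê∉Bi = ⊥-elim (ℕₚ.1+n≢n (≡.sym (dim-unique (S′ i) dim-k′ (dim-S′-ê∉ i ê∉Bi))))

    S′-large⇒ê∉ : ∀ i → HasDim (S′ i) (suc k′) → ¬ (ê ∈ B i)
    S′-large⇒ê∉ i dim-suc-k′ ê∈Bi = ℕₚ.1+n≢n (dim-unique (S′ i) dim-suc-k′ (dim-S′-ê∈ i ê∈Bi))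

    S̃ : Fin b̃ → Subspace n′
    S̃ j = S′ (e j)

    dim-S̃ : ∀ j → HasDim (S̃ j) k′
    dim-S̃ j = dim-S′-ê∈ (e j) (ê∈Be j)

    S̃-complete : ∀ i → HasDim (S′ i) k′ → ∃ λ j → e j ≡ i
    S̃-complete i dim-k′ = e-hits i (S′-small⇒ê∈ i dim-k′)

    -- A t′-space T lies in S̃ j iff the cone hat T lies in B (e j).
    S̃-steiner : ∀ T → HasDim T t′ → ∃ λ j → T ⊆ S̃ j × (∀ j′ → T ⊆ S̃ j′ → j′ ≡ j)
    S̃-steiner T dimT = j , T⊆S̃j , unique
      where
      dim-hatT = hat-dim {T = T} dimT
      i = block (hat T) dim-hatT
      j = proj₁ (e-hits i (U⊆block (hat T) dim-hatT ê (ê∈hat T)))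
      ej≡i = proj₂ (e-hits i (U⊆block (hat T) dim-hatT ê (ê∈hat T)))
      T⊆S̃j : T ⊆ S̃ j
      T⊆S̃j = ≡.subst (λ x → T ⊆ S′ x) (≡.sym ej≡i)
        (⊆-trans {U = T} {puncture (hat T)} (proj₂ (puncture-hat T)) (puncture-mono {U = hat T} {B i} (U⊆block (hat T) dim-hatT)))
      unique : ∀ j′ → T ⊆ S̃ j′ → j′ ≡ j
      unique j′ T⊆S̃j′ = e-injective (≡.trans (block-unique (hat T) dim-hatT (e j′) (hat⊆ T {B (e j′)} (ê∈Be j′) T⊆S̃j′))
                                              (≡.sym ej≡i))

    -- Blocks through ê are determined by their puncturing, and two distinct
    -- blocks cannot share a (t′+1)-subspace.
    S̃-distinct : ∀ j j′ → j ≢ j′ → ¬ (S̃ j ≐ S̃ j′)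
    S̃-distinct j j′ j≢j′ (S̃j⊆S̃j′ , _) = j≢j′ (e-injective (≡.trans (block-unique T dimT (e j) T⊆Bej)
                                                                    (≡.sym (block-unique T dimT (e j′) T⊆Bej′))))
      where
      T⊆Bej-data = subspace-exists {V = B (e j)} (dimB (e j)) (s≤s t′≤k′)
      T = proj₁ T⊆Bej-data
      dimT = proj₁ (proj₂ T⊆Bej-data)
      T⊆Bej = proj₂ (proj₂ T⊆Bej-data)
      Bej⊆Bej′ : B (e j) ⊆ B (e j′)
      Bej⊆Bej′ = puncture-reflects-⊆-ê (B (e j)) (B (e j′)) (ê∈Be j′) S̃j⊆S̃j′
      T⊆Bej′ = ⊆-trans {U = T} {B (e j)} T⊆Bej Bej⊆Bej′

    -- (ii): a (t′+1)-space inside some S̃ j lies in no punctured block of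
    -- dimension k′+1: its lift into that block would also lie in B (e j).
    covered⇒avoids-large-blocks : ∀ T → HasDim T (suc t′) → (∃ λ j → T ⊆ S̃ j) → ∀ i → HasDim (S′ i) (suc k′) → ¬ (T ⊆ S′ i)
    covered⇒avoids-large-blocks T (β , β-indep , β⊆T , _) (j , T⊆S̃j) i dim-S′i T⊆S′i =
      S′-large⇒ê∉ i dim-S′i (≡.subst (λ x → ê ∈ B x) (≡.sym i≡ej) (ê∈Be j))
      where
      lifted = lift-exists β (B i) (⊆-trans {U = span β} {T} β⊆T T⊆S′i)
      Λ = lift β (proj₁ lifted)
      dimΛ = lift-dim β (proj₁ lifted) β-indep
      Λ⊆Bej : Λ ⊆ B (e j)
      Λ⊆Bej = lift⊆ β (proj₁ lifted) (B (e j)) (ê∈Be j) (⊆-trans {U = span β} {T} β⊆T T⊆S̃j)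
      i≡ej : i ≡ e j
      i≡ej = ≡.trans (block-unique Λ dimΛ i (proj₂ lifted)) (≡.sym (block-unique Λ dimΛ (e j) Λ⊆Bej))

    -- (iii): a (t′+1)-space T = ⟨β⟩ in no S̃ j has q^{t′+1} lifts; they lie
    -- in pairwise different blocks, which are exactly the (k′+1)-dimensional
    -- punctured blocks containing T.
    uncovered⇒large-block-count : ∀ T → HasDim T (suc t′) → (∀ j → ¬ (T ⊆ S̃ j)) →
      HasCount b (λ i → HasDim (S′ i) (suc k′) × T ⊆ S′ i) (q ℕ.^ suc t′)
    uncovered⇒large-block-count T (β , β-indep , β⊆T , T⊆β) T∉S̃ = f , f-injective , f-sat , f-hits
      where
      Λ : Fin (q ℕ.^ suc t′) → Subspace (suc n′)
      Λ a = lift β (coeffs (suc t′) a)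
      dimΛ : ∀ a → HasDim (Λ a) (suc t′)
      dimΛ a = lift-dim β (coeffs (suc t′) a) β-indep
      f : Fin (q ℕ.^ suc t′) → Fin b
      f a = block (Λ a) (dimΛ a)
      T⊆S′f : ∀ a → T ⊆ S′ (f a)
      T⊆S′f a = ⊆-trans {U = T} {span β} T⊆β (⊆-trans {U = span β} {puncture (Λ a)}
        (proj₂ (puncture-lift β (coeffs (suc t′) a))) (puncture-mono {U = Λ a} {B (f a)} (U⊆block (Λ a) (dimΛ a))))
      ê∉Bf : ∀ a → ¬ (ê ∈ B (f a))
      ê∉Bf a ê∈Bfa = let j , ej≡fa = e-hits (f a) ê∈Bfa in
        T∉S̃ j (≡.subst (λ x → T ⊆ S′ x) (≡.sym ej≡fa) (T⊆S′f a))
      f-sat : ∀ a → HasDim (S′ (f a)) (suc k′) × T ⊆ S′ (f a)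
      f-sat a = dim-S′-ê∉ (f a) (ê∉Bf a) , T⊆S′f a
      f-injective : Injective _≡_ _≡_ f
      f-injective {a} {a′} fa≡fa′ = by-cases (coeffs (suc t′) a ≈ᵛ? coeffs (suc t′) a′)
        where
        by-cases : Dec (coeffs (suc t′) a ≈ᵛ coeffs (suc t′) a′) → a ≡ a′
        by-cases (yes same)  = coeffs-injective (suc t′) a a′ same
        by-cases (no differ) = ⊥-elim (ê∉Bf a (lift-diff β {coeffs (suc t′) a} {coeffs (suc t′) a′} (B (f a)) r
            (U⊆block (Λ a) (dimΛ a)) (≡.subst (λ x → Λ a′ ⊆ B x) (≡.sym fa≡fa′) (U⊆block (Λ a′) (dimΛ a′))) cr≉c′r))
          where
          r = proj₁ (≉⇒differ-at (coeffs (suc t′) a) (coeffs (suc t′) a′) differ)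
          cr≉c′r = proj₂ (≉⇒differ-at (coeffs (suc t′) a) (coeffs (suc t′) a′) differ)
      f-hits : ∀ i → HasDim (S′ i) (suc k′) × T ⊆ S′ i → ∃ λ a → f a ≡ i
      f-hits i (_ , T⊆S′i) = a , ≡.sym (block-unique (Λ a) (dimΛ a) i Λa⊆Bi)
        where
        lifted = lift-exists β (B i) (⊆-trans {U = span β} {T} β⊆T T⊆S′i)
        a = proj₁ (coeffs-surjective (suc t′) (proj₁ lifted))
        Λa⊆Bi : Λ a ⊆ B i
        Λa⊆Bi = ⊆-trans {U = Λ a} {lift β (proj₁ lifted)}
          (proj₁ (lift-cong β (proj₂ (coeffs-surjective (suc t′) (proj₁ lifted))))) (proj₂ lifted)

open import Data.Nat using (_*_; _^_; _≤_; _∸_)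

theorem7 : (q : ℕ) (F : FiniteField q) (t k n' : ℕ) →
  1 ≤ t → t ≤ k → k ≤ suc n' →
  (b : ℕ) (B : Fin b → Lin.Subspace F (suc n')) →
  Lin.IsSteiner F t k (suc n') b B →
  let open Lin F
      S' : Fin b → Subspace n'
      S' i = puncture (B i)
  in ∃ λ (b~ : ℕ) → ∃ λ (e : Fin b~ → Fin b) →
       -- (i)
       Injective _≡_ _≡_ e ×
       (∀ j → HasDim (S' (e j)) (k ∸ 1)) ×
       (∀ i → HasDim (S' i) (k ∸ 1) → ∃ λ j → e j ≡ i) ×
       b~ * gauss q (k ∸ 1) (t ∸ 1) ≡ gauss q n' (t ∸ 1) ×
       (∀ j j' → j ≢ j' → ¬ (S' (e j) ≐ S' (e j'))) ×
       IsSteiner (t ∸ 1) (k ∸ 1) n' b~ (λ j → S' (e j)) ×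
       -- (ii)
       (∀ T → HasDim T t → (∃ λ j → T ⊆ S' (e j)) →
          ∀ i → HasDim (S' i) k → ¬ (T ⊆ S' i)) ×
       -- (iii)
       (∀ T → HasDim T t → (∀ j → ¬ (T ⊆ S' (e j))) →
          HasCount b (λ i → HasDim (S' i) k × T ⊆ S' i) (q ^ t))
theorem7 q F (suc t′) (suc k′) n′ _ (s≤s t′≤k′) _ b B steiner =
  b̃ , e , e-injective , dim-S̃ , S̃-complete ,
  steiner-count S̃ (dim-S̃ , S̃-steiner) ,
  S̃-distinct , (dim-S̃ , S̃-steiner) ,
  covered⇒avoids-large-blocks , uncovered⇒large-block-count
  where
  open Geometry F
  open PuncturedSystem t′ k′ n′ t′≤k′ b B steiner
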